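{- Let $\Omega$ be a set of orderings with $n$ elements, let $x$ and $y$ be two distinct initial elements of $\Omega$, and suppose $x\prec y$. Then $\bar r(x)<\frac{n+1}{3}$.
   Context: A set of orderings $\Omega$ on a finite set $S$ of $n$ elements is a nonempty set of total orderings of $S$. For distinct elements $a,b$, $\Pr[a<b]$ is the probability that $a$ occurs earlier than $b$ in a uniformly random ordering from $\Omega$, and $a\prec b$ means $\Pr[a<b]>\frac23$. The rank of an element in an ordering is its position (first position is $1$), and $\bar r(a)$ is the expected rank of $a$ in a uniformly random ordering from $\Omega$. An element $a$ is initial if, in any ordering of $\Omega$ in which $a$ is not the first element, swapping $a$ with its immediate predecessor produces another ordering of $\Omega$. -}

module Defs where

open import Data.Nat using (ℕ; zero; suc; _+_; _*_; _<_; _<?_)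
open import Data.Fin using (Fin; _≟_)
open import Data.List using (List; []; _∷_; _++_; length; filter; map; allFin)
open import Data.Nat.ListAction using (sum)
open import Data.List.Membership.Propositional using (_∈_)
open import Data.List.Relation.Binary.Permutation.Propositional using (_↭_)
open import Data.List.Relation.Unary.All using (All)
open import Data.List.Relation.Unary.Unique.Propositional using (Unique)
open import Relation.Nullary using (¬_; yes; no)
open import Relation.Binary.PropositionalEquality using (_≡_)

-- A total ordering of S = Fin n is a list listing every element exactly once
-- (a permutation of allFin n); the first list entry is the first element.
IsOrdering : (n : ℕ) → List (Fin n) → Set
IsOrdering n σ = σ ↭ allFin n

record SetOfOrderings (n : ℕ) : Set where
  field
    Ω         : List (List (Fin n))
    orderings : All (IsOrdering n) Ω
    distinct  : Unique Ω
    nonempty  : ¬ (Ω ≡ [])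

-- rank a σ : the (1-based) position of a in the ordering σ.
rank : ∀ {n} → Fin n → List (Fin n) → ℕ
rank a [] = 0
rank a (b ∷ σ) with a ≟ b
... | yes _ = 1
... | no  _ = suc (rank a σ)

countBefore : ∀ {n} → List (List (Fin n)) → Fin n → Fin n → ℕ
countBefore Ω a b = length (filter (λ σ → rank a σ <? rank b σ) Ω)

-- Pr[a<b] > 2/3, i.e. a ≺ b, cleared of denominators: 3·#{a before b} > 2·|Ω|
_≺⟨_⟩_ : ∀ {n} → Fin n → SetOfOrderings n → Fin n → Set
a ≺⟨ O ⟩ b = 2 * length (SetOfOrderings.Ω O) < 3 * countBefore (SetOfOrderings.Ω O) a b

-- sum over Ω of the rank of a (so r̄(a) = totalRank / |Ω|)
totalRank : ∀ {n} → SetOfOrderings n → Fin n → ℕ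
totalRank O a = sum (map (rank a) (SetOfOrderings.Ω O))

Initial : ∀ {n} → SetOfOrderings n → Fin n → Set
Initial {n} O a =
  ∀ (l₁ l₂ : List (Fin n)) (b : Fin n) →
    (l₁ ++ b ∷ a ∷ l₂) ∈ SetOfOrderings.Ω O →
    (l₁ ++ a ∷ b ∷ l₂) ∈ SetOfOrderings.Ω O

module Submission where

-- Let x, y be distinct elements with y initial and x ≺ y.  Split Ω into
-- Ω< (x before y) and Ω> (y before x); write r(σ) for the rank of x in σ.
--
-- Double counting.  Take σ ∈ Ω< and 0 ≤ k < r(σ).  Because y is initial it
-- may be moved forward, one transposition at a time, to position k+1; the
-- result τ lies in Ω> and r(τ) = r(σ) + 1.  Recording, besides τ, the
-- distance p by which y travelled beyond x's old place, (σ , k) ↦ (τ , p) is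
-- injective (σ is recovered by moving y back) and p < n + 1 − r(τ).  Hence
--     Σ_{Ω<} r  ≤  Σ_{Ω>} (n + 1 − r),   so   Σ_Ω r ≤ (n + 1)·|Ω>|.
-- Finally x ≺ y means 3|Ω<| > 2|Ω|, i.e. 3|Ω>| < |Ω|, which gives
-- 3 Σ_Ω r < (n + 1)|Ω|.

open import Defs
open import Level using (Level)
open import Data.Nat using (ℕ; zero; suc; pred; _+_; _*_; _∸_; _≤_; _<_; _≤′_; ≤′-refl; ≤′-step; _<?_; z≤n; s≤s)
open import Data.Nat.Properties
  using (≤-trans; <⇒≤; <-asym; ≤-pred; n≤1+n; ≤⇒≤′; ∸-monoˡ-<; m∸n+n≡m; +-comm; +-assoc; +-suc;
         *-suc; *-zeroʳ; *-distribˡ-+; *-distribʳ-+; *-identityˡ; +-cancelˡ-<; +-monoˡ-<; +-monoˡ-≤;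
         *-monoʳ-≤; *-monoʳ-<; +-commutativeSemigroup; *-commutativeSemigroup; module ≤-Reasoning)
import Algebra.Properties.CommutativeSemigroup as CommutativeSemigroupProperties
open CommutativeSemigroupProperties +-commutativeSemigroup using (interchange) renaming (x∙yz≈y∙xz to +-swapˡ)
open CommutativeSemigroupProperties *-commutativeSemigroup using () renaming (x∙yz≈y∙xz to *-swapˡ)
open import Data.Fin using (Fin; _≟_)
open import Data.List using (List; []; _∷_; _++_; length; map; upTo; filter)
open import Data.Nat.ListAction using (sum)
open import Data.List.Properties using (length-map; length-++; length-upTo; length-tabulate; length-removeAt′; filter-all)
open import Data.List.Membership.Propositional using (_∈_; _∉_)
open import Data.List.Membership.Propositional.Properties
  using (∈-map⁺; ∈-map⁻; ∈-++⁺ˡ; ∈-++⁺ʳ; ∈-++⁻; ∈-upTo⁺; ∈-upTo⁻; ∈-allFin; ∈-filter⁺; ∈-filter⁻)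
open import Data.List.Relation.Unary.Any as Any using (here; there)
open import Data.List.Relation.Unary.All as All using (All; []; _∷_)
open import Data.List.Relation.Unary.All.Properties using (¬Any⇒All¬)
open import Data.List.Relation.Unary.AllPairs using ([]; _∷_)
open import Data.List.Relation.Unary.Unique.Propositional using (Unique)
import Data.List.Relation.Unary.Unique.Propositional.Properties as Unique
open import Data.List.Relation.Binary.Permutation.Propositional using (↭-sym; ↭⇒↭ₛ)
open import Data.List.Relation.Binary.Permutation.Propositional.Properties using (∈-resp-↭; ↭-length)
import Data.List.Relation.Binary.Permutation.Setoid.Properties as SetoidPermutation
open import Data.Product using (_×_; _,_; proj₁; proj₂; ∃; uncurry)
open import Data.Sum using (_⊎_; inj₁; inj₂)
open import Data.Empty using (⊥)
open import Function using (_∘_)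
open import Relation.Nullary using (¬_; yes; no; ¬?; contradiction)
open import Relation.Unary using (Pred; Decidable)
open import Relation.Unary.Properties using (∁?)
open import Relation.Binary.PropositionalEquality
  using (_≡_; refl; sym; trans; cong; cong₂; subst; subst₂; setoid; module ≡-Reasoning)

∈-─ : ∀ {A : Set} {v w : A} {ys : List A} (w∈ys : w ∈ ys) → v ∈ ys → ¬ v ≡ w → v ∈ (ys Any.─ w∈ys)
∈-─ (here refl) (here refl) v≢w = contradiction refl v≢w
∈-─ (here _)    (there v∈)  _   = v∈
∈-─ (there _)   (here v≡)   _   = here v≡
∈-─ (there w∈)  (there v∈)  v≢w = there (∈-─ w∈ v∈ v≢w)

injection-length : ∀ {A B : Set} (F : A → B) (G : B → A) {xs : List A} {ys : List B} →
  Unique xs → (∀ {a} → a ∈ xs → G (F a) ≡ a) → (∀ {a} → a ∈ xs → F a ∈ ys) →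
  length xs ≤ length ys
injection-length F G {[]} _ _ _ = z≤n
injection-length F G {a ∷ xs} {ys} (a∉xs ∷ unique) retract into =
  subst (suc (length xs) ≤_) (sym (length-removeAt′ ys (Any.index Fa∈ys)))
    (s≤s (injection-length F G unique (λ b∈ → retract (there b∈))
            (λ b∈ → ∈-─ Fa∈ys (into (there b∈)) (F-separates b∈))))
  where
  Fa∈ys : F a ∈ ys
  Fa∈ys = into (here refl)
  F-separates : ∀ {b} → b ∈ xs → ¬ F b ≡ F a
  F-separates {b} b∈xs Fb≡Fa = All.lookup a∉xs b∈xs (begin
      a       ≡⟨ sym (retract (here refl)) ⟩
      G (F a) ≡⟨ cong G (sym Fb≡Fa) ⟩
      G (F b) ≡⟨ retract (there b∈xs) ⟩
      b       ∎)
    where open ≡-Reasoning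

under : ∀ {A : Set} → (A → ℕ) → List A → List (A × ℕ)
under f []       = []
under f (a ∷ as) = map (a ,_) (upTo (f a)) ++ under f as

length-under : ∀ {A : Set} (f : A → ℕ) (xs : List A) → length (under f xs) ≡ sum (map f xs)
length-under f []       = refl
length-under f (a ∷ as) = begin
  length (map (a ,_) (upTo (f a)) ++ under f as)         ≡⟨ length-++ (map (a ,_) (upTo (f a))) ⟩
  length (map (a ,_) (upTo (f a))) + length (under f as) ≡⟨ cong₂ _+_ (length-map (a ,_) (upTo (f a))) (length-under f as) ⟩
  length (upTo (f a)) + sum (map f as)                   ≡⟨ cong (_+ sum (map f as)) (length-upTo (f a)) ⟩
  f a + sum (map f as)                                   ∎
  where open ≡-Reasoning

∈-under⁺ : ∀ {A : Set} {f : A → ℕ} {xs : List A} {a k} → a ∈ xs → k < f a → (a , k) ∈ under f xs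
∈-under⁺ {xs = b ∷ bs} (here refl) k<fa = ∈-++⁺ˡ (∈-map⁺ (b ,_) (∈-upTo⁺ k<fa))
∈-under⁺ {f = f} {xs = b ∷ bs} (there a∈) k<fa = ∈-++⁺ʳ (map (b ,_) (upTo (f b))) (∈-under⁺ a∈ k<fa)

∈-under⁻ : ∀ {A : Set} {f : A → ℕ} {xs : List A} {p : A × ℕ} →
  p ∈ under f xs → proj₁ p ∈ xs × proj₂ p < f (proj₁ p)
∈-under⁻ {f = f} {xs = b ∷ bs} p∈ with ∈-++⁻ (map (b ,_) (upTo (f b))) p∈
... | inj₁ p∈row with ∈-map⁻ (b ,_) p∈row
...   | k , k∈ , refl = here refl , ∈-upTo⁻ k∈
∈-under⁻ {xs = b ∷ bs} p∈ | inj₂ p∈rest = let (a∈ , k<) = ∈-under⁻ p∈rest in there a∈ , k<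

under-unique : ∀ {A : Set} {f : A → ℕ} {xs : List A} → Unique xs → Unique (under f xs)
under-unique {xs = []} [] = []
under-unique {f = f} {xs = b ∷ bs} (b∉bs ∷ unique) =
  Unique.++⁺ (Unique.map⁺ (cong proj₂) (Unique.upTo⁺ (f b))) (under-unique unique) disjoint
  where
  disjoint : ∀ {p} → p ∈ map (b ,_) (upTo (f b)) × p ∈ under f bs → ⊥
  disjoint (p∈row , p∈rest) with ∈-map⁻ (b ,_) p∈row
  ... | _ , _ , refl = All.lookup b∉bs (proj₁ (∈-under⁻ p∈rest)) refl

double-counting : ∀ {A B : Set} {f : A → ℕ} {g : B → ℕ} {xs : List A} {ys : List B}
  (F : A × ℕ → B × ℕ) (G : B × ℕ → A × ℕ) → Unique xs →
  (∀ {a k} → a ∈ xs → k < f a → G (F (a , k)) ≡ (a , k)) →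
  (∀ {a k} → a ∈ xs → k < f a → proj₁ (F (a , k)) ∈ ys × proj₂ (F (a , k)) < g (proj₁ (F (a , k)))) →
  sum (map f xs) ≤ sum (map g ys)
double-counting {f = f} {g} {xs} {ys} F G unique retract into =
  subst₂ _≤_ (length-under f xs) (length-under g ys)
    (injection-length F G (under-unique unique)
      (λ p∈ → uncurry retract (∈-under⁻ p∈))
      (λ p∈ → uncurry ∈-under⁺ (uncurry into (∈-under⁻ p∈))))

ins : ∀ {A : Set} → ℕ → A → List A → List A
ins zero    a ρ       = a ∷ ρ
ins (suc k) a []      = a ∷ []
ins (suc k) a (b ∷ ρ) = b ∷ ins k a ρ

ins-suc : ∀ {A : Set} k (a : A) ρ → ins (suc k) a ρ ≡ ins k a ρ ⊎
  ∃ λ l₁ → ∃ λ b → ∃ λ l₂ → ins (suc k) a ρ ≡ l₁ ++ b ∷ a ∷ l₂ × ins k a ρ ≡ l₁ ++ a ∷ b ∷ l₂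
ins-suc zero    a []      = inj₁ refl
ins-suc zero    a (b ∷ ρ) = inj₂ ([] , b , ρ , refl , refl)
ins-suc (suc k) a []      = inj₁ refl
ins-suc (suc k) a (b ∷ ρ) with ins-suc k a ρ
... | inj₁ same = inj₁ (cong (b ∷_) same)
... | inj₂ (l₁ , c , l₂ , later , earlier) = inj₂ (b ∷ l₁ , c , l₂ , cong (b ∷_) later , cong (b ∷_) earlier)

del : ∀ {n} → Fin n → List (Fin n) → List (Fin n)
del y = filter (λ b → ¬? (y ≟ b))

module _ {n : ℕ} where

  del-∉ : ∀ {y : Fin n} ρ → y ∉ ρ → del y ρ ≡ ρ
  del-∉ {y} ρ y∉ρ = filter-all (λ b → ¬? (y ≟ b)) (¬Any⇒All¬ ρ y∉ρ)

  ∉-del : ∀ {y : Fin n} σ → y ∉ del y σ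
  ∉-del {y} σ y∈ = proj₂ (∈-filter⁻ (λ b → ¬? (y ≟ b)) {xs = σ} y∈) refl

  ∈-del : ∀ {y z : Fin n} σ → z ∈ σ → ¬ z ≡ y → z ∈ del y σ
  ∈-del {y} σ z∈σ z≢y = ∈-filter⁺ (λ b → ¬? (y ≟ b)) z∈σ (z≢y ∘ sym)

  rank-of-member : ∀ {y : Fin n} σ → y ∈ σ → rank y σ ≡ suc (pred (rank y σ))
  rank-of-member {y} (b ∷ σ) _ with y ≟ b
  ... | yes _ = refl
  ... | no _  = refl

  del-ins : ∀ {y : Fin n} k ρ → y ∉ ρ → del y (ins k y ρ) ≡ ρ
  del-ins {y} zero ρ y∉ρ with y ≟ y
  ... | yes _   = del-∉ ρ y∉ρ
  ... | no y≢y  = contradiction refl y≢y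
  del-ins {y} (suc k) [] _ with y ≟ y
  ... | yes _   = refl
  ... | no y≢y  = contradiction refl y≢y
  del-ins {y} (suc k) (b ∷ ρ) y∉ with y ≟ b
  ... | yes y≡b = contradiction (here y≡b) y∉
  ... | no _    = cong (b ∷_) (del-ins k ρ (y∉ ∘ there))

  ins-del : ∀ {y : Fin n} σ → Unique σ → y ∈ σ → ins (pred (rank y σ)) y (del y σ) ≡ σ
  ins-del {y} (b ∷ σ) (b∉σ ∷ _) y∈ with y ≟ b
  ... | yes refl = cong (y ∷_) (del-∉ σ (λ y∈σ → All.lookup b∉σ y∈σ refl))
  ins-del {y} (b ∷ σ) (_ ∷ unique) (here y≡b) | no y≢b = contradiction y≡b y≢b
  ins-del {y} (b ∷ σ) (_ ∷ unique) (there y∈σ) | no _ =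
    trans (cong (λ r → ins r y (b ∷ del y σ)) (rank-of-member σ y∈σ)) (cong (b ∷_) (ins-del σ unique y∈σ))

  -- A rank never exceeds the length (an absent element gets rank length σ).
  rank-≤-length : ∀ (a : Fin n) σ → rank a σ ≤ length σ
  rank-≤-length a []      = z≤n
  rank-≤-length a (b ∷ σ) with a ≟ b
  ... | yes _ = s≤s z≤n
  ... | no _  = s≤s (rank-≤-length a σ)

  rank-ins-self : ∀ {y : Fin n} k ρ → y ∉ ρ → k ≤ length ρ → rank y (ins k y ρ) ≡ suc k
  rank-ins-self {y} zero ρ _ _ with y ≟ y
  ... | yes _  = refl
  ... | no y≢y = contradiction refl y≢y
  rank-ins-self {y} (suc k) (b ∷ ρ) y∉ (s≤s k≤) with y ≟ b
  ... | yes y≡b = contradiction (here y≡b) y∉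
  ... | no _    = cong suc (rank-ins-self k ρ (y∉ ∘ there) k≤)

  rank-ins-before : ∀ {x y : Fin n} k ρ → ¬ x ≡ y → k < rank x ρ → rank x (ins k y ρ) ≡ suc (rank x ρ)
  rank-ins-before {x} {y} zero ρ x≢y _ with x ≟ y
  ... | yes x≡y = contradiction x≡y x≢y
  ... | no _    = refl
  rank-ins-before {x} {y} (suc k) (b ∷ ρ) x≢y k< with x ≟ b
  rank-ins-before {x} {y} (suc k) (b ∷ ρ) x≢y (s≤s ()) | yes _
  ... | no _ = cong suc (rank-ins-before k ρ x≢y (≤-pred k<))

  rank-ins-stays : ∀ {x y : Fin n} k ρ → ¬ x ≡ y → x ∈ ρ → rank x (ins k y ρ) ≤ k →
    rank x (ins k y ρ) ≡ rank x ρ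
  rank-ins-stays {x} {y} zero ρ x≢y _ ≤k with x ≟ y
  rank-ins-stays {x} {y} zero ρ x≢y _ () | yes _
  rank-ins-stays {x} {y} zero ρ x≢y _ () | no _
  rank-ins-stays {x} {y} (suc k) (b ∷ ρ) x≢y x∈ ≤k with x ≟ b
  ... | yes _ = refl
  rank-ins-stays {x} {y} (suc k) (b ∷ ρ) x≢y (here x≡b) ≤k | no x≢b = contradiction x≡b x≢b
  rank-ins-stays {x} {y} (suc k) (b ∷ ρ) x≢y (there x∈) (s≤s ≤k) | no _ =
    cong suc (rank-ins-stays k ρ x≢y x∈ ≤k)

module _ {n : ℕ} {σ : List (Fin n)} (ordering : IsOrdering n σ) where

  ordering-unique : Unique σ
  ordering-unique = SetoidPermutation.Unique-resp-↭ (setoid (Fin n)) (↭⇒↭ₛ (↭-sym ordering)) (Unique.allFin⁺ n)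

  ordering-complete : (a : Fin n) → a ∈ σ
  ordering-complete a = ∈-resp-↭ (↭-sym ordering) (∈-allFin a)

  ordering-length : length σ ≡ n
  ordering-length = trans (↭-length ordering) (length-tabulate {n = n} (λ i → i))

rank-≤-n : ∀ {n} (O : SetOfOrderings n) (a : Fin n) {σ} → σ ∈ SetOfOrderings.Ω O → rank a σ ≤ n
rank-≤-n O a {σ} σ∈Ω =
  subst (rank a σ ≤_) (ordering-length (All.lookup (SetOfOrderings.orderings O) σ∈Ω)) (rank-≤-length a σ)

initial-forward : ∀ {n} (O : SetOfOrderings n) {y : Fin n} → Initial O y →
  ∀ {k j} ρ → k ≤ j → ins j y ρ ∈ SetOfOrderings.Ω O → ins k y ρ ∈ SetOfOrderings.Ω O
initial-forward O {y} initial ρ k≤j = forward (≤⇒≤′ k≤j)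
  where
  open SetOfOrderings O
  one-step : ∀ j → ins (suc j) y ρ ∈ Ω → ins j y ρ ∈ Ω
  one-step j σ∈ with ins-suc j y ρ
  ... | inj₁ same = subst (_∈ Ω) same σ∈
  ... | inj₂ (l₁ , b , l₂ , later , earlier) = subst (_∈ Ω) (sym earlier) (initial l₁ l₂ b (subst (_∈ Ω) later σ∈))
  forward : ∀ {k j} → k ≤′ j → ins j y ρ ∈ Ω → ins k y ρ ∈ Ω
  forward ≤′-refl        σ∈ = σ∈
  forward (≤′-step k≤′j) σ∈ = forward k≤′j (one-step _ σ∈)

module _ {A : Set} {ℓ : Level} {P : Pred A ℓ} (P? : Decidable P) where

  length-filter-split : ∀ xs → length (filter P? xs) + length (filter (∁? P?) xs) ≡ length xs
  length-filter-split []       = refl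
  length-filter-split (a ∷ xs) with P? a
  ... | yes _ = cong suc (length-filter-split xs)
  ... | no _  = trans (+-suc _ _) (cong suc (length-filter-split xs))

  sum-filter-split : ∀ (f : A → ℕ) xs →
    sum (map f xs) ≡ sum (map f (filter P? xs)) + sum (map f (filter (∁? P?) xs))
  sum-filter-split f []       = refl
  sum-filter-split f (a ∷ xs) with P? a
  ... | yes _ = trans (cong (f a +_) (sum-filter-split f xs)) (sym (+-assoc (f a) (sum (map f (filter P? xs))) _))
  ... | no _  = trans (cong (f a +_) (sum-filter-split f xs)) (+-swapˡ (f a) (sum (map f (filter P? xs))) _)

sum-complement : ∀ {A : Set} (c : ℕ) (f : A → ℕ) xs → All (λ a → f a ≤ c) xs →
  sum (map (λ a → c ∸ f a) xs) + sum (map f xs) ≡ c * length xs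
sum-complement c f []       []           = sym (*-zeroʳ c)
sum-complement c f (a ∷ xs) (fa≤c ∷ f≤c) = begin
  (c ∸ f a + sum (map (λ b → c ∸ f b) xs)) + (f a + sum (map f xs)) ≡⟨ interchange (c ∸ f a) _ (f a) _ ⟩
  (c ∸ f a + f a) + (sum (map (λ b → c ∸ f b) xs) + sum (map f xs)) ≡⟨ cong₂ _+_ (m∸n+n≡m fa≤c) (sum-complement c f xs f≤c) ⟩
  c + c * length xs                                                 ≡⟨ sym (*-suc c (length xs)) ⟩
  c * suc (length xs)                                               ∎
  where open ≡-Reasoning

minority-bound : ∀ {C D N} → C + D ≡ N → 2 * N < 3 * C → 3 * D < N
minority-bound {C} {D} {N} C+D≡N 2N<3C = subst (3 * D <_) C+D≡N (begin-strict
  3 * D         ≡⟨ *-distribʳ-+ D 2 1 ⟩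
  2 * D + 1 * D ≡⟨ cong (2 * D +_) (*-identityˡ D) ⟩
  2 * D + D     <⟨ +-monoˡ-< D 2D<C ⟩
  C + D         ∎)
  where
  open ≤-Reasoning
  2D<C : 2 * D < C
  2D<C = +-cancelˡ-< (2 * C) (2 * D) C (subst₂ _<_
    (trans (cong (2 *_) (sym C+D≡N)) (*-distribˡ-+ 2 C D))
    (trans (*-distribʳ-+ C 2 1) (cong (2 * C +_) (*-identityˡ C))) 2N<3C)

module MoveInitial {n : ℕ} (O : SetOfOrderings n) {x y : Fin n} (x≢y : ¬ x ≡ y) (y-initial : Initial O y) where
  open SetOfOrderings O

  x-before-y? : Decidable (λ (σ : List (Fin n)) → rank x σ < rank y σ)
  x-before-y? σ = rank x σ <? rank y σ

  Ω< Ω> : List (List (Fin n))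
  Ω< = filter x-before-y? Ω
  Ω> = filter (∁? x-before-y?) Ω

  -- (σ , k) ↦ (σ with y moved to rank k + 1 , distance y travelled past x's place)
  move-y : List (Fin n) × ℕ → List (Fin n) × ℕ
  move-y (σ , k) = ins k y (del y σ) , pred (rank y σ) ∸ rank x σ

  move-y-back : List (Fin n) × ℕ → List (Fin n) × ℕ
  move-y-back (τ , p) = ins (p + pred (rank x τ)) y (del y τ) , pred (rank y τ)

  module Move {σ : List (Fin n)} {k : ℕ} (σ∈Ω : σ ∈ Ω) (x<y : rank x σ < rank y σ) (k<x : k < rank x σ) where
    ρ : List (Fin n)
    ρ = del y σ
    s : ℕ
    s = pred (rank y σ)
    τ : List (Fin n)
    τ = ins k y ρ

    σ-ordering : IsOrdering n σ
    σ-ordering = All.lookup orderings σ∈Ω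

    σ-decomposes : ins s y ρ ≡ σ
    σ-decomposes = ins-del σ (ordering-unique σ-ordering) (ordering-complete σ-ordering y)

    y∉ρ : y ∉ ρ
    y∉ρ = ∉-del σ

    y-in-σ : rank y σ ≡ suc s
    y-in-σ = rank-of-member σ (ordering-complete σ-ordering y)

    s<n : s < n
    s<n = subst (_≤ n) y-in-σ (rank-≤-n O y σ∈Ω)

    x≤s : rank x σ ≤ s
    x≤s = ≤-pred (subst (rank x σ <_) y-in-σ x<y)

    -- x precedes y in σ, so removing y does not move x
    x-in-σ : rank x σ ≡ rank x ρ
    x-in-σ = trans (cong (rank x) (sym σ-decomposes))
      (rank-ins-stays s ρ x≢y (∈-del σ (ordering-complete σ-ordering x) x≢y)
        (subst (λ σ′ → rank x σ′ ≤ s) (sym σ-decomposes) x≤s))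

    xρ≤s : rank x ρ ≤ s
    xρ≤s = subst (_≤ s) x-in-σ x≤s

    k<xρ : k < rank x ρ
    k<xρ = subst (k <_) x-in-σ k<x

    x-in-τ : rank x τ ≡ suc (rank x ρ)
    x-in-τ = rank-ins-before k ρ x≢y k<xρ

    y-in-τ : rank y τ ≡ suc k
    y-in-τ = rank-ins-self k ρ y∉ρ (≤-trans (<⇒≤ k<xρ) (rank-≤-length x ρ))

    τ∈Ω> : τ ∈ Ω>
    τ∈Ω> = ∈-filter⁺ (∁? x-before-y?) τ∈Ω y-before-x
      where
      τ∈Ω : τ ∈ Ω
      τ∈Ω = initial-forward O y-initial ρ (≤-trans (<⇒≤ k<xρ) xρ≤s) (subst (_∈ Ω) (sym σ-decomposes) σ∈Ω)
      y-before-x : ¬ rank x τ < rank y τ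
      y-before-x x<y′ = <-asym k<xρ (≤-pred (subst₂ _<_ x-in-τ y-in-τ x<y′))

    travel-bound : pred (rank y σ) ∸ rank x σ < suc n ∸ rank x τ
    travel-bound = subst₂ (λ a b → s ∸ a < suc n ∸ b) (sym x-in-σ) (sym x-in-τ)
      (∸-monoˡ-< s<n xρ≤s)

    move-back : move-y-back (move-y (σ , k)) ≡ (σ , k)
    move-back = cong₂ _,_ (begin
        ins ((s ∸ rank x σ) + pred (rank x τ)) y (del y τ) ≡⟨ cong₂ (λ i l → ins i y l) travel+x (del-ins k ρ y∉ρ) ⟩
        ins s y ρ                                          ≡⟨ σ-decomposes ⟩
        σ                                                  ∎)
      (cong pred y-in-τ)
      where
      open ≡-Reasoning
      travel+x : (s ∸ rank x σ) + pred (rank x τ) ≡ s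
      travel+x = trans (cong₂ (λ a b → (s ∸ a) + pred b) x-in-σ x-in-τ)
                       (m∸n+n≡m xρ≤s)

  rank-mass-bound : sum (map (rank x) Ω<) ≤ sum (map (λ τ → suc n ∸ rank x τ) Ω>)
  rank-mass-bound = double-counting move-y move-y-back (Unique.filter⁺ x-before-y? distinct)
    (λ σ∈ k< → let (σ∈Ω , x<y) = ∈-filter⁻ x-before-y? σ∈ in Move.move-back σ∈Ω x<y k<)
    (λ σ∈ k< → let (σ∈Ω , x<y) = ∈-filter⁻ x-before-y? σ∈ in Move.τ∈Ω> σ∈Ω x<y k< , Move.travel-bound σ∈Ω x<y k<)

  total-rank-bound : totalRank O x ≤ suc n * length Ω>
  total-rank-bound = begin
    sum (map (rank x) Ω)                                          ≡⟨ sum-filter-split x-before-y? (rank x) Ω ⟩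
    sum (map (rank x) Ω<) + sum (map (rank x) Ω>)                 ≤⟨ +-monoˡ-≤ (sum (map (rank x) Ω>)) rank-mass-bound ⟩
    sum (map (λ τ → suc n ∸ rank x τ) Ω>) + sum (map (rank x) Ω>) ≡⟨ sum-complement (suc n) (rank x) Ω> ranks-≤ ⟩
    suc n * length Ω>                                             ∎
    where
    open ≤-Reasoning
    ranks-≤ : All (λ τ → rank x τ ≤ suc n) Ω>
    ranks-≤ = All.tabulate (λ τ∈ → ≤-trans (rank-≤-n O x (proj₁ (∈-filter⁻ (∁? x-before-y?) τ∈))) (n≤1+n n))

lemma8 : (n : ℕ) (O : SetOfOrderings n) (x y : Fin n) →
    ¬ (x ≡ y) → Initial O x → Initial O y → x ≺⟨ O ⟩ y →
    3 * totalRank O x < (n + 1) * length (SetOfOrderings.Ω O)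
lemma8 n O x y x≢y _ y-initial x≺y = begin-strict
  3 * totalRank O x      ≤⟨ *-monoʳ-≤ 3 total-rank-bound ⟩
  3 * (suc n * |Ω>|)     ≡⟨ *-swapˡ 3 (suc n) |Ω>| ⟩
  suc n * (3 * |Ω>|)     <⟨ *-monoʳ-< (suc n) (minority-bound {length Ω<} (length-filter-split x-before-y? Ω) x≺y) ⟩
  suc n * length Ω       ≡⟨ cong (_* length Ω) (+-comm 1 n) ⟩
  (n + 1) * length Ω     ∎
  where
  open ≤-Reasoning
  open SetOfOrderings O
  open MoveInitial O x≢y y-initial
  |Ω>| : ℕ
  |Ω>| = length Ω>
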